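{- Let $\mathbb{F}$ be a field of characteristic different from $2$ and $n\ge 2$. There exists an $(n+3)\times(n+3)$ matrix $E$ with entries in $\mathcal{X}\cup\mathbb{F}$ such that \[\Sigma_{\{x_{1,1},x_{2,2}\}}\mathsf{perm}_n(X)=\mathsf{perm}(E),\] where $X=(x_{i,j})_{i,j\in[n]}$.
   Context: $\mathsf{perm}_n(X)=\sum_{\pi\in S_n}\prod_i x_{i,\pi(i)}$ for the $n\times n$ matrix $X$ of distinct indeterminates; $\mathcal{X}$ denotes the set of indeterminates. For a set $S$ of variables, $\Sigma_S p=p_S|_{y=0}+p_S|_{y=1}$ where $p_S$ is $p$ with every variable of $S$ replaced by one new variable $y$; here $\Sigma_{\{x_{1,1},x_{2,2}\}}\mathsf{perm}_n=\mathsf{perm}_n|_{x_{1,1}=x_{2,2}=0}+\mathsf{perm}_n|_{x_{1,1}=x_{2,2}=1}$. -}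

module Defs where

open import Level using (Level; _⊔_)
open import Algebra.Bundles using (CommutativeRing)
open import Algebra.Morphism.Structures using (module RingMorphisms)
open import Data.Nat using (ℕ; zero; suc)
open import Data.Fin using (Fin; zero; suc)
open import Data.Fin.Properties using (_≟_)
open import Data.Vec using (Vec; []; _∷_; lookup)
open import Data.List using (List; []; _∷_; map; concatMap; filter; foldr)
open import Data.List.Base using (allFin)
open import Data.Product using (_×_; _,_; ∃)
open import Data.Sum using (_⊎_; inj₁; inj₂)
open import Data.Bool using (if_then_else_)
open import Relation.Nullary using (¬_; Dec; does)
open import Relation.Nullary.Decidable using (⌊_⌋)
open import Relation.Binary.PropositionalEquality using (_≡_)
open import Data.Vec.Relation.Unary.Unique.Propositional using (Unique)
import Data.Vec.Relation.Unary.Unique.Propositional.Properties as UP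
open import Data.Vec.Relation.Unary.AllPairs using (allPairs?)
open import Relation.Nullary.Decidable using (¬?)

record Field (c ℓ : Level) : Set (Level.suc (c ⊔ ℓ)) where
  field
    commutativeRing : CommutativeRing c ℓ
  open CommutativeRing commutativeRing public
    using (Carrier; _≈_; _+_; _*_; 0#; 1#)
  field
    1≉0     : ¬ (1# ≈ 0#)
    inverse : ∀ x → ¬ (x ≈ 0#) → ∃ λ y → x * y ≈ 1#

CharNot2 : ∀ {c ℓ} → Field c ℓ → Set ℓ
CharNot2 F = ¬ (1# + 1# ≈ 0#) where open Field F

record Algebra {c ℓ} (F : Field c ℓ) (a ℓa : Level) : Set (c ⊔ ℓ ⊔ Level.suc (a ⊔ ℓa)) where
  field
    ring : CommutativeRing a ℓa
    ι    : Field.Carrier F → CommutativeRing.Carrier ring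
    ι-hom : RingMorphisms.IsRingHomomorphism
              (CommutativeRing.rawRing (Field.commutativeRing F))
              (CommutativeRing.rawRing ring) ι

allVecs : ∀ k m → List (Vec (Fin m) k)
allVecs zero    m = [] ∷ []
allVecs (suc k) m = concatMap (λ i → map (i ∷_) (allVecs k m)) (allFin m)

unique? : ∀ {k m} (v : Vec (Fin m) k) → Dec (Unique v)
unique? v = allPairs? (λ x y → ¬? (x ≟ y)) v

permutations : ∀ m → List (Vec (Fin m) m)
permutations m = filter unique? (allVecs m m)

module _ {a ℓa} (R : CommutativeRing a ℓa) where
  open CommutativeRing R using (Carrier; _+_; _*_; 0#; 1#)

  prodFin : ∀ m → (Fin m → Carrier) → Carrier
  prodFin zero    f = 1#
  prodFin (suc m) f = f zero * prodFin m (λ i → f (suc i))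

  perm : ∀ m → (Fin m → Fin m → Carrier) → Carrier
  perm m M = foldr (λ π s → prodFin m (λ i → M i (lookup π i)) + s) 0#
                   (permutations m)

-- entries in 𝒳 ∪ 𝔽: either the indeterminate x_{i,j} or a field constant
Entry : ∀ {c ℓ} → Field c ℓ → ℕ → Set c
Entry F n = (Fin n × Fin n) ⊎ Field.Carrier F

module _ {c ℓ a ℓa} {F : Field c ℓ} (A : Algebra F a ℓa) where
  open Algebra A
  open CommutativeRing ring using (Carrier; _+_; 0#; 1#)

  evalEntry : ∀ {n} → (Fin n × Fin n → Carrier) → Entry F n → Carrier
  evalEntry x (inj₁ ij) = x ij
  evalEntry x (inj₂ f)  = ι f

  X-sub : ∀ k → (Fin (suc (suc k)) × Fin (suc (suc k)) → Carrier) → Carrier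
        → Fin (suc (suc k)) → Fin (suc (suc k)) → Carrier
  X-sub k x y zero       zero       = y
  X-sub k x y (suc zero) (suc zero) = y
  X-sub k x y i          j          = x (i , j)

  ΣPerm : ∀ k → (Fin (suc (suc k)) × Fin (suc (suc k)) → Carrier) → Carrier
  ΣPerm k x = perm ring (suc (suc k)) (X-sub k x 0#)
            + perm ring (suc (suc k)) (X-sub k x 1#)

-- Write X₀ for X with x₁₁ = x₂₂ = 0, and M₁, M₂, M₁₂ for the minors of X₀ obtained by
-- deleting row and column 1, 2, or both. The permanent is affine in each row, so
--   Σ perm X = perm X₀ + perm (X₀ + E₁₁ + E₂₂) = 2 perm X₀ + M₁ + M₂ + M₁₂.
-- E borders X₀ by three rows and columns: on the rows of X₀ the new columns are e₁, e₂ and 0,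
-- and the new rows carry a 3 × 3 block of constants together with a 1 in column 1, resp. 2,
-- of X₀. Expanding perm E along the new rows writes it as a combination of permanents of
-- the rows of X₀ on the columns left over. Those that keep the zero column vanish by
-- counting; the others are perm X₀, M₁, M₂, M₁₂ and two further minors, and with the
-- constants built from ½ their coefficients are 2, 1, 1, 1, 0 and 0.

module Submission where

open import Defs
open import Level using (_⊔_)
open import Algebra.Bundles using (CommutativeRing)
open import Algebra.Morphism.Structures using (module RingMorphisms)
open import Data.Bool using (Bool; true; false; if_then_else_; _∧_)
open import Data.Bool.Properties using (∧-zeroʳ; ∧-identityʳ)
open import Data.Fin using (Fin; zero; suc; cast; punchIn)
open import Data.Fin.Patterns using (0F; 1F; 2F; 3F; 4F)
open import Data.Fin.Properties using (_≟_; cast-is-id; punchInᵢ≢i; suc-injective)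
open import Data.Fin.Subset using (Subset; inside; outside; ⊤; ∣_∣; _-_)
open import Data.Fin.Subset.Properties using (x∈p⇒∣p-x∣<∣p∣; p─⊥≡p; ∣p∣≤n)
open import Data.Nat as ℕ using (ℕ; zero; suc; _<_; _≤_; s≤s)
open import Data.Nat.Properties using (<-≤-trans; +-comm)
open import Data.Product using (Σ; _×_; _,_)
open import Data.Sum using (inj₁; inj₂)
import Data.Vec as Vec
open import Data.Vec using (Vec; lookup; _[_]≔_)
open import Data.Vec.Properties
  using (lookup∘updateAt; lookup∘updateAt′; []≔-commutes; lookup⇒[]=; lookup-replicate)
open import Data.Vec.Functional using (tail; updateAt; removeAt)
open import Data.Vec.Functional.Properties using (updateAt-updates; updateAt-minimal)
open import Data.Vec.Relation.Unary.All using (all?)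
open import Function using (const; _∘_)
open import Relation.Nullary using (Dec; does; yes; no; ¬?; contradiction)
open import Relation.Nullary.Decidable using (dec-true; dec-false)
open import Relation.Binary.PropositionalEquality as ≡ using (_≡_; _≢_)

-- Rectangular permanents

module RectangularPermanent {a ℓ} (R : CommutativeRing a ℓ) where
  open CommutativeRing R hiding (zero; _-_)
  open import Algebra.Properties.Semiring.Sum semiring
    using (sum; sum-syntax; sum-cong-≋; sum-cong-≗; sum-replicate-zero; ∑-distrib-+; *-distribˡ-sum)
  open import Data.List using (List; []; _∷_; map; concatMap; filter; foldr; allFin; tabulate; _++_)
  open import Data.Vec using ([]; _∷_)
  open import Relation.Binary.Reasoning.Setoid setoid

  when : Bool → Carrier → Carrier
  when b x = if b then x else 0#

  -- Sum over the injective placements of the rows of M into the available columns A of the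
  -- products of the entries hit; with A = ⊤ and M square this is the permanent.
  permOn : ∀ {m N} → Subset N → (Fin m → Fin N → Carrier) → Carrier
  permOn {zero}      A M = 1#
  permOn {suc m} {N} A M =
    ∑[ j < N ] when (lookup A j) (M zero j * permOn (A [ j ]≔ outside) (tail M))

  cofactor : ∀ {m N} → Subset N → (Fin m → Fin N → Carrier) → Fin N → Carrier
  cofactor A M j = permOn (A [ j ]≔ outside) M

  when-cong : ∀ b {x y} → x ≈ y → when b x ≈ when b y
  when-cong true  x≈y = x≈y
  when-cong false x≈y = refl

  when-0 : ∀ b {x} → x ≈ 0# → when b x ≈ 0#
  when-0 true  x≈0 = x≈0
  when-0 false x≈0 = refl

  when-+ : ∀ b x y → when b (x + y) ≈ when b x + when b y
  when-+ true  x y = refl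
  when-+ false x y = sym (+-identityˡ 0#)

  when-*ˡ : ∀ b x y → x * when b y ≈ when b (x * y)
  when-*ˡ true  x y = refl
  when-*ˡ false x y = zeroʳ x

  when-∧ : ∀ a b x y → when (a ∧ b) (x * y) ≈ when a (x * when b y)
  when-∧ true  b x y = sym (when-*ˡ b x y)
  when-∧ false b x y = refl

  when-swap : ∀ a b x y z → when a (x * when b (y * z)) ≈ when b (y * when a (x * z))
  when-swap true  true  x y z = trans (sym (*-assoc x y z)) (trans (*-congʳ (*-comm x y)) (*-assoc y x z))
  when-swap true  false x y z = zeroʳ x
  when-swap false true  x y z = sym (zeroʳ y)
  when-swap false false x y z = refl

  ∑-0 : ∀ {N} (f : Fin N → Carrier) → (∀ j → f j ≈ 0#) → sum f ≈ 0#
  ∑-0 {N} f f≈0 = trans (sum-cong-≋ f≈0) (sum-replicate-zero N)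

  ∑-single : ∀ {N} (c : Fin N) (f : Fin N → Carrier) → (∀ j → j ≢ c → f j ≈ 0#) → sum f ≈ f c
  ∑-single zero    f f≈0 = trans (+-congˡ (∑-0 _ λ j → f≈0 (suc j) λ ())) (+-identityʳ _)
  ∑-single (suc c) f f≈0 =
    trans (+-cong (f≈0 zero λ ()) (∑-single c (f ∘ suc) λ j j≢c → f≈0 (suc j) (j≢c ∘ suc-injective)))
          (+-identityˡ _)

  ∑-when-+ : ∀ {N} (b : Fin N → Bool) (f g : Fin N → Carrier) →
             ∑[ j < N ] when (b j) (f j + g j) ≈ ∑[ j < N ] when (b j) (f j) + ∑[ j < N ] when (b j) (g j)
  ∑-when-+ b f g =
    trans (sum-cong-≋ λ j → when-+ (b j) _ _)
          (∑-distrib-+ (λ j → when (b j) (f j)) (λ j → when (b j) (g j)))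

  ∑-when-*ˡ : ∀ {N} b x (f : Fin N → Carrier) → ∑[ j < N ] when b (x * f j) ≈ when b (x * sum f)
  ∑-when-*ˡ     true  x f = sym (*-distribˡ-sum x f)
  ∑-when-*ˡ {N} false x f = ∑-0 {N} (λ _ → 0#) (λ _ → refl)

  lookup-removed : ∀ {N} (A : Subset N) j → lookup (A [ j ]≔ outside) j ≡ outside
  lookup-removed A j = lookup∘updateAt j A

  lookup-kept : ∀ {N} (A : Subset N) {i j} → i ≢ j → lookup (A [ j ]≔ outside) i ≡ lookup A i
  lookup-kept A {i} {j} i≢j = lookup∘updateAt′ i j i≢j A

  []≔outside≡- : ∀ {N} (A : Subset N) j → A [ j ]≔ outside ≡ A - j
  []≔outside≡- (s ∷ A) zero    = ≡.cong (outside ∷_) (≡.sym (p─⊥≡p A))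
  []≔outside≡- (s ∷ A) (suc j) = ≡.cong (s ∷_) ([]≔outside≡- A j)

  ∣[]≔outside∣< : ∀ {N} (A : Subset N) {j} → lookup A j ≡ inside → ∣ A [ j ]≔ outside ∣ < ∣ A ∣
  ∣[]≔outside∣< A {j} j∈A rewrite []≔outside≡- A j = x∈p⇒∣p-x∣<∣p∣ (lookup⇒[]= j A j∈A)

  permOn-cong : ∀ {m N} (A : Subset N) {M M′ : Fin m → Fin N → Carrier} →
                (∀ i j → M i j ≈ M′ i j) → permOn A M ≈ permOn A M′
  permOn-cong {zero}  A M≈M′ = refl
  permOn-cong {suc m} A M≈M′ =
    sum-cong-≋ λ j → when-cong (lookup A j) (*-cong (M≈M′ zero j) (permOn-cong _ (M≈M′ ∘ suc)))

  permOn-+-row : ∀ {m N} (A : Subset N) (M : Fin m → Fin N → Carrier) i (u v : Fin N → Carrier) →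
                 (∀ j → M i j ≈ u j + v j) →
                 permOn A M ≈ permOn A (updateAt M i (const u)) + permOn A (updateAt M i (const v))
  permOn-+-row A M zero    u v Mᵢ≈u+v =
    trans (sum-cong-≋ λ j → when-cong (lookup A j) (trans (*-congʳ (Mᵢ≈u+v j)) (distribʳ _ _ _)))
          (∑-when-+ (lookup A) _ _)
  permOn-+-row A M (suc i) u v Mᵢ≈u+v =
    trans (sum-cong-≋ λ j → when-cong (lookup A j)
                              (trans (*-congˡ (permOn-+-row _ (tail M) i u v Mᵢ≈u+v)) (distribˡ _ _ _)))
          (∑-when-+ (lookup A) _ _)

  permOn-unitRow : ∀ {m N} (A : Subset N) (M : Fin (suc m) → Fin N → Carrier) i c →
                   (∀ j → j ≢ c → M i j ≈ 0#) →
                   permOn A M ≈ when (lookup A c) (M i c * cofactor A (removeAt M i) c)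
  permOn-unitRow A M zero c Mᵢ≈0 =
    ∑-single c _ λ j j≢c → when-0 (lookup A j) (trans (*-congʳ (Mᵢ≈0 j j≢c)) (zeroˡ _))
  permOn-unitRow {suc m} A M (suc i) c Mᵢ≈0 =
    trans (sum-cong-≋ λ j → when-cong (lookup A j) (*-congˡ (permOn-unitRow _ (tail M) i c Mᵢ≈0)))
          (trans (sum-cong-≋ exchange)
                 (∑-when-*ˡ (lookup A c) (M (suc i) c) λ j →
                    when (lookup (A [ c ]≔ outside) j) (M zero j * P (A [ c ]≔ outside [ j ]≔ outside))))
    where
    P : Subset _ → Carrier
    P B = permOn B (removeAt (tail M) i)

    exchange : ∀ j →
      when (lookup A j) (M zero j * when (lookup (A [ j ]≔ outside) c)
                                          (M (suc i) c * P (A [ j ]≔ outside [ c ]≔ outside)))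
      ≈ when (lookup A c) (M (suc i) c * when (lookup (A [ c ]≔ outside) j)
                                              (M zero j * P (A [ c ]≔ outside [ j ]≔ outside)))
    exchange j with j ≟ c
    ... | yes ≡.refl rewrite lookup-removed A j =
      trans (when-0 (lookup A j) (zeroʳ _)) (sym (when-0 (lookup A j) (zeroʳ _)))
    ... | no j≢c rewrite lookup-kept A (j≢c ∘ ≡.sym) | lookup-kept A j≢c
                       | []≔-commutes {x = outside} {y = outside} A j c j≢c =
      when-swap (lookup A j) (lookup A c) _ _ _

  permOn-zeroColumn : ∀ {m N} (A : Subset N) (M : Fin m → Fin N → Carrier) c →
                      (∀ i → M i c ≈ 0#) → permOn A M ≈ permOn (A [ c ]≔ outside) M
  permOn-zeroColumn {zero}  A M c M·c≈0 = refl
  permOn-zeroColumn {suc m} A M c M·c≈0 = sum-cong-≋ term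
    where
    term : ∀ j → when (lookup A j) (M zero j * cofactor A (tail M) j)
               ≈ when (lookup (A [ c ]≔ outside) j) (M zero j * cofactor (A [ c ]≔ outside) (tail M) j)
    term j with j ≟ c
    ... | yes ≡.refl rewrite lookup-removed A j =
      when-0 (lookup A j) (trans (*-congʳ (M·c≈0 zero)) (zeroˡ _))
    ... | no j≢c rewrite lookup-kept A j≢c | []≔-commutes {x = outside} {y = outside} A c j (j≢c ∘ ≡.sym) =
      when-cong (lookup A j) (*-congˡ (permOn-zeroColumn _ (tail M) c (M·c≈0 ∘ suc)))

  permOn-vanishes : ∀ {m N} (A : Subset N) (M : Fin m → Fin N → Carrier) → ∣ A ∣ < m → permOn A M ≈ 0#
  permOn-vanishes {suc m} A M (s≤s ∣A∣≤m) = ∑-0 _ term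
    where
    term : ∀ j → when (lookup A j) (M zero j * cofactor A (tail M) j) ≈ 0#
    term j with lookup A j in j∈A
    ... | false = refl
    ... | true  = trans (*-congˡ (permOn-vanishes _ (tail M) (<-≤-trans (∣[]≔outside∣< A j∈A) ∣A∣≤m)))
                        (zeroʳ _)

  permOn-vanishes-zeroColumn : ∀ {m N} (A : Subset N) (M : Fin m → Fin N → Carrier) c →
                               lookup A c ≡ inside → ∣ A ∣ ≤ m → (∀ i → M i c ≈ 0#) →
                               permOn A M ≈ 0#
  permOn-vanishes-zeroColumn A M c c∈A ∣A∣≤m M·c≈0 =
    trans (permOn-zeroColumn A M c M·c≈0)
          (permOn-vanishes _ M (<-≤-trans (∣[]≔outside∣< A c∈A) ∣A∣≤m))

  -- Split row i into its entry at c and the rest: the rest leaves column c zero, so it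
  -- contributes nothing by counting, and the entry at c is a unit row.
  permOn-unitColumn : ∀ {m N} (A : Subset N) (M : Fin (suc m) → Fin N → Carrier) i c →
                      lookup A c ≡ inside → ∣ A ∣ ≤ suc m → (∀ r → r ≢ i → M r c ≈ 0#) →
                      permOn A M ≈ M i c * cofactor A (removeAt M i) c
  permOn-unitColumn {N = N} A M i c c∈A ∣A∣≤ M·c≈0 =
    trans (permOn-+-row A M i rest single split)
          (trans (+-cong (permOn-vanishes-zeroColumn A (updateAt M i (const rest)) c c∈A ∣A∣≤ rest·c≈0)
                         (permOn-unitRow A (updateAt M i (const single)) i c single≈0))
                 (trans (+-identityˡ _) (singleTerm c∈A)))
    where
    rest single : Fin N → Carrier
    rest   j = if does (c ≟ j) then 0#    else M i j
    single j = if does (c ≟ j) then M i c else 0#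

    split : ∀ j → M i j ≈ rest j + single j
    split j with c ≟ j
    ... | yes ≡.refl = sym (+-identityˡ _)
    ... | no  _      = sym (+-identityʳ _)

    rest·c≈0 : ∀ r → updateAt M i (const rest) r c ≈ 0#
    rest·c≈0 r with r ≟ i
    ... | yes ≡.refl rewrite updateAt-updates r {const rest} M | dec-true (c ≟ c) ≡.refl = refl
    ... | no  r≢i    rewrite updateAt-minimal r i {const rest} M r≢i = M·c≈0 r r≢i

    single≈0 : ∀ j → j ≢ c → updateAt M i (const single) i j ≈ 0#
    single≈0 j j≢c rewrite updateAt-updates i {const single} M | dec-false (c ≟ j) (j≢c ∘ ≡.sym) = refl

    singleTerm : lookup A c ≡ inside →
                 when (lookup A c) (updateAt M i (const single) i c
                                     * cofactor A (removeAt (updateAt M i (const single)) i) c)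
                 ≈ M i c * cofactor A (removeAt M i) c
    singleTerm c∈A rewrite c∈A | updateAt-updates i {const single} M | dec-true (c ≟ c) ≡.refl =
      *-congˡ (permOn-cong _ λ r j →
        reflexive (≡.cong (λ row → row j) (updateAt-minimal (punchIn i r) i M (punchInᵢ≢i i r))))

  permOn-dropColumn : ∀ {m N} (A : Subset N) (M : Fin m → Fin (suc N) → Carrier) →
                      permOn (outside ∷ A) M ≈ permOn A (λ i j → M i (suc j))
  permOn-dropColumn {zero}  A M = refl
  permOn-dropColumn {suc m} A M =
    trans (+-identityˡ _) (sum-cong-≋ λ j → when-cong (lookup A j) (*-congˡ (permOn-dropColumn _ (tail M))))

  permOn-cast : ∀ {m m′} (m≡m′ : m ≡ m′) (M : Fin m′ → Fin m′ → Carrier) →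
                permOn ⊤ (λ i j → M (cast m≡m′ i) (cast m≡m′ j)) ≈ permOn ⊤ M
  permOn-cast ≡.refl M =
    permOn-cong ⊤ λ i j → reflexive (≡.cong₂ M (cast-is-id ≡.refl i) (cast-is-id ≡.refl j))

  -- Agreement with the permanent as a sum over permutations

  listSum : ∀ {X : Set} → List X → (X → Carrier) → Carrier
  listSum xs f = foldr (λ x s → f x + s) 0# xs

  listSum-cong : ∀ {X : Set} (xs : List X) {f g : X → Carrier} →
                 (∀ x → f x ≈ g x) → listSum xs f ≈ listSum xs g
  listSum-cong []       f≈g = refl
  listSum-cong (x ∷ xs) f≈g = +-cong (f≈g x) (listSum-cong xs f≈g)

  listSum-++ : ∀ {X : Set} (xs ys : List X) f → listSum (xs ++ ys) f ≈ listSum xs f + listSum ys f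
  listSum-++ []       ys f = sym (+-identityˡ _)
  listSum-++ (x ∷ xs) ys f = trans (+-congˡ (listSum-++ xs ys f)) (sym (+-assoc _ _ _))

  listSum-concatMap : ∀ {X Y : Set} (g : X → List Y) xs f →
                      listSum (concatMap g xs) f ≈ listSum xs (λ x → listSum (g x) f)
  listSum-concatMap g []       f = refl
  listSum-concatMap g (x ∷ xs) f = trans (listSum-++ (g x) _ f) (+-congˡ (listSum-concatMap g xs f))

  listSum-map : ∀ {X Y : Set} (g : X → Y) xs f → listSum (map g xs) f ≡ listSum xs (f ∘ g)
  listSum-map g []       f = ≡.refl
  listSum-map g (x ∷ xs) f = ≡.cong (f (g x) +_) (listSum-map g xs f)

  listSum-tabulate : ∀ {X : Set} {N} (g : Fin N → X) f → listSum (tabulate g) f ≡ sum (f ∘ g)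
  listSum-tabulate {N = zero}  g f = ≡.refl
  listSum-tabulate {N = suc N} g f = ≡.cong (f (g zero) +_) (listSum-tabulate (g ∘ suc) f)

  listSum-when-*ˡ : ∀ {X : Set} (xs : List X) b y f →
                    listSum xs (λ x → when b (y * f x)) ≈ when b (y * listSum xs f)
  listSum-when-*ˡ []       true  y f = sym (zeroʳ y)
  listSum-when-*ˡ []       false y f = refl
  listSum-when-*ˡ (x ∷ xs) b     y f =
    trans (+-congˡ (listSum-when-*ˡ xs b y f)) (trans (sym (when-+ b _ _)) (when-cong b (sym (distribˡ y _ _))))

  listSum-filter : ∀ {X : Set} {p} {P : X → Set p} (P? : ∀ x → Dec (P x)) xs f →
                   listSum (filter P? xs) f ≈ listSum xs (λ x → when (does (P? x)) (f x))
  listSum-filter P? []       f = refl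
  listSum-filter P? (x ∷ xs) f with does (P? x)
  ... | true  = +-congˡ (listSum-filter P? xs f)
  ... | false = trans (listSum-filter P? xs f) (sym (+-identityˡ _))

  allInside : ∀ {k N} → Subset N → Vec (Fin N) k → Bool
  allInside A []      = true
  allInside A (j ∷ v) = lookup A j ∧ allInside A v

  allInside-⊤ : ∀ {k N} (v : Vec (Fin N) k) → allInside ⊤ v ≡ true
  allInside-⊤ []      = ≡.refl
  allInside-⊤ (j ∷ v) rewrite lookup-replicate j inside = allInside-⊤ v

  avoidsᵇ : ∀ {k N} → Fin N → Vec (Fin N) k → Bool
  avoidsᵇ i v = does (all? (λ j → ¬? (i ≟ j)) v)

  allInside-[]≔outside : ∀ {k N} (A : Subset N) i (v : Vec (Fin N) k) →
                         allInside (A [ i ]≔ outside) v ≡ avoidsᵇ i v ∧ allInside A v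
  allInside-[]≔outside A i []      = ≡.refl
  allInside-[]≔outside A i (j ∷ v) with i ≟ j
  ... | yes ≡.refl rewrite lookup-removed A i = ≡.refl
  ... | no  i≢j    rewrite lookup-kept A (i≢j ∘ ≡.sym) | allInside-[]≔outside A i v =
    ∧-exchange (lookup A j) (avoidsᵇ i v) (allInside A v)
    where
    ∧-exchange : ∀ x y z → x ∧ (y ∧ z) ≡ y ∧ (x ∧ z)
    ∧-exchange true  y z = ≡.refl
    ∧-exchange false y z = ≡.sym (∧-zeroʳ y)

  listSum-allVecs : ∀ {k N} (A : Subset N) (M : Fin k → Fin N → Carrier) →
    listSum (allVecs k N) (λ v → when (does (unique? v) ∧ allInside A v) (prodFin R k (λ i → M i (lookup v i))))
    ≈ permOn A M
  listSum-allVecs {zero}      A M = +-identityʳ 1#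
  listSum-allVecs {suc k} {N} A M = begin
    listSum (concatMap (λ i → map (i ∷_) (allVecs k N)) (allFin N)) G
      ≈⟨ listSum-concatMap (λ i → map (i ∷_) (allVecs k N)) (allFin N) G ⟩
    listSum (allFin N) (λ i → listSum (map (i ∷_) (allVecs k N)) G)
      ≡⟨ listSum-tabulate (λ i → i) (λ i → listSum (map (i ∷_) (allVecs k N)) G) ⟩
    ∑[ i < N ] listSum (map (i ∷_) (allVecs k N)) G
      ≡⟨ sum-cong-≗ (λ i → listSum-map (i ∷_) (allVecs k N) G) ⟩
    ∑[ i < N ] listSum (allVecs k N) (λ w → G (i ∷ w))
      ≈⟨ sum-cong-≋ (λ i → listSum-cong (allVecs k N) (G-∷ i)) ⟩
    ∑[ i < N ] listSum (allVecs k N) (λ w → when (lookup A i) (M zero i * G′ i w))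
      ≈⟨ sum-cong-≋ (λ i → listSum-when-*ˡ (allVecs k N) (lookup A i) (M zero i) (G′ i)) ⟩
    ∑[ i < N ] when (lookup A i) (M zero i * listSum (allVecs k N) (G′ i))
      ≈⟨ sum-cong-≋ (λ i → when-cong (lookup A i) (*-congˡ (listSum-allVecs _ (tail M)))) ⟩
    permOn A M ∎
    where
    G : Vec (Fin N) (suc k) → Carrier
    G v = when (does (unique? v) ∧ allInside A v) (prodFin R (suc k) (λ i → M i (lookup v i)))

    Π′ : Vec (Fin N) k → Carrier
    Π′ w = prodFin R k (λ r → M (suc r) (lookup w r))

    G′ : Fin N → Vec (Fin N) k → Carrier
    G′ i w = when (does (unique? w) ∧ allInside (A [ i ]≔ outside) w) (Π′ w)

    ∧-shuffle : ∀ d u a f → (d ∧ u) ∧ (a ∧ f) ≡ a ∧ (u ∧ (d ∧ f))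
    ∧-shuffle true  u true  f = ≡.refl
    ∧-shuffle false u true  f = ≡.sym (∧-zeroʳ u)
    ∧-shuffle d     u false f = ∧-zeroʳ (d ∧ u)

    G-∷ : ∀ i w → G (i ∷ w) ≈ when (lookup A i) (M zero i * G′ i w)
    G-∷ i w = trans (reflexive (≡.cong (λ b → when b (M zero i * Π′ w)) weights))
                    (when-∧ (lookup A i) _ (M zero i) (Π′ w))
      where
      weights : (avoidsᵇ i w ∧ does (unique? w)) ∧ (lookup A i ∧ allInside A w)
              ≡ lookup A i ∧ (does (unique? w) ∧ allInside (A [ i ]≔ outside) w)
      weights = ≡.trans (∧-shuffle (avoidsᵇ i w) (does (unique? w)) (lookup A i) (allInside A w))
                        (≡.cong (λ b → lookup A i ∧ (does (unique? w) ∧ b))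
                                (≡.sym (allInside-[]≔outside A i w)))

  perm≈permOn : ∀ m (M : Fin m → Fin m → Carrier) → perm R m M ≈ permOn ⊤ M
  perm≈permOn m M =
    trans (listSum-filter unique? (allVecs m m) Π)
          (trans (listSum-cong (allVecs m m) λ v → reflexive (≡.cong (λ b → when b (Π v)) (alsoInside v)))
                 (listSum-allVecs ⊤ M))
    where
    Π : Vec (Fin m) m → Carrier
    Π v = prodFin R m (λ i → M i (lookup v i))

    alsoInside : ∀ v → does (unique? v) ≡ does (unique? v) ∧ allInside ⊤ v
    alsoInside v = ≡.sym (≡.trans (≡.cong (does (unique? v) ∧_) (allInside-⊤ v)) (∧-identityʳ _))

-- The bordered matrix

module Bordering {a ℓ} (R : CommutativeRing a ℓ) (h : CommutativeRing.Carrier R) (k : ℕ) where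
  open CommutativeRing R hiding (zero; _-_)
  open RectangularPermanent R
  open import Algebra.Properties.Semiring.Sum semiring using (sum-syntax)
  open import Data.Vec.Functional using (_∷_)

  private
    infixr 5 _⁰+_
    infixl 6 _+⁰_

    _⁰+_ : ∀ {x y z} → z ≈ 0# → x ≈ y → z + x ≈ y
    z≈0 ⁰+ x≈y = trans (+-cong z≈0 x≈y) (+-identityˡ _)

    _+⁰_ : ∀ {x y z} → x ≈ y → z ≈ 0# → x + z ≈ y
    x≈y +⁰ z≈0 = trans (+-cong x≈y z≈0) (+-identityʳ _)

    1*_ : ∀ {x y} → x ≈ y → 1# * x ≈ y
    1* x≈y = trans (*-identityˡ _) x≈y

    vanishesʳ : ∀ {x y} → x ≈ 0# → y * x ≈ 0#
    vanishesʳ x≈0 = trans (*-congˡ x≈0) (zeroʳ _)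

    vanishesˡ : ∀ {x y} → x ≈ 0# → x * y ≈ 0#
    vanishesˡ x≈0 = trans (*-congʳ x≈0) (zeroˡ _)

  n N : ℕ
  n = suc (suc k)
  N = suc (suc (suc n))

  Matrix : Set a
  Matrix = Fin n → Fin n → Carrier

  diag : Matrix
  diag 0F 0F = 1#
  diag 1F 1F = 1#
  diag _  _  = 0#

  diag-row₀ : ∀ j → j ≢ 0F → diag 0F j ≈ 0#
  diag-row₀ 0F      0≢0 = contradiction ≡.refl 0≢0
  diag-row₀ (suc j) _   = refl

  diag-row₁ : ∀ j → j ≢ 1F → diag 1F j ≈ 0#
  diag-row₁ 0F            _   = refl
  diag-row₁ 1F            1≢1 = contradiction ≡.refl 1≢1
  diag-row₁ (suc (suc j)) _   = refl

  diag-column₀ : ∀ i → i ≢ 0F → diag i 0F ≈ 0#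
  diag-column₀ 0F            0≢0 = contradiction ≡.refl 0≢0
  diag-column₀ 1F            _   = refl
  diag-column₀ (suc (suc i)) _   = refl

  diag-column₁ : ∀ i → i ≢ 1F → diag i 1F ≈ 0#
  diag-column₁ 0F            _   = refl
  diag-column₁ 1F            1≢1 = contradiction ≡.refl 1≢1
  diag-column₁ (suc (suc i)) _   = refl

  minor₀ minor₁ minor₀₁ : Matrix → Carrier
  minor₀  X = permOn (⊤ [ 0F ]≔ outside) (removeAt X 0F)
  minor₁  X = permOn (⊤ [ 1F ]≔ outside) (removeAt X 1F)
  minor₀₁ X = permOn (⊤ [ 0F ]≔ outside [ 1F ]≔ outside) (λ i → X (suc (suc i)))

  permOn-+diag : ∀ (X : Matrix) →
                 permOn ⊤ (λ i j → X i j + diag i j) ≈ (permOn ⊤ X + minor₁ X) + (minor₀ X + minor₀₁ X)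
  permOn-+diag X =
    trans (permOn-+-row ⊤ Y 0F (X 0F) (diag 0F) (λ _ → refl))
          (+-cong (trans (permOn-+-row ⊤ Yˣ 1F (X 1F) (diag 1F) (λ _ → refl)) (+-cong keepBoth placeRow₁))
                  (trans (permOn-+-row ⊤ Yᵈ 1F (X 1F) (diag 1F) (λ _ → refl)) (+-cong placeRow₀ placeBoth)))
    where
    Y Yˣ Yᵈ Yˣˣ Yˣᵈ Yᵈˣ Yᵈᵈ : Matrix
    Y i j = X i j + diag i j
    Yˣ    = updateAt Y 0F (const (X 0F))
    Yᵈ    = updateAt Y 0F (const (diag 0F))
    Yˣˣ   = updateAt Yˣ 1F (const (X 1F))
    Yˣᵈ   = updateAt Yˣ 1F (const (diag 1F))
    Yᵈˣ   = updateAt Yᵈ 1F (const (X 1F))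
    Yᵈᵈ   = updateAt Yᵈ 1F (const (diag 1F))

    lower : ∀ i j → Y (suc (suc i)) j ≈ X (suc (suc i)) j
    lower i j = +-identityʳ _

    keepBoth : permOn ⊤ Yˣˣ ≈ permOn ⊤ X
    keepBoth = permOn-cong ⊤ rows
      where
      rows : ∀ i j → Yˣˣ i j ≈ X i j
      rows 0F            j = refl
      rows 1F            j = refl
      rows (suc (suc i)) j = lower i j

    placeRow₁ : permOn ⊤ Yˣᵈ ≈ minor₁ X
    placeRow₁ = trans (permOn-unitRow ⊤ Yˣᵈ 1F 1F diag-row₁) (1* permOn-cong (⊤ [ 1F ]≔ outside) rows)
      where
      rows : ∀ i j → removeAt Yˣᵈ 1F i j ≈ removeAt X 1F i j
      rows 0F      j = refl
      rows (suc i) j = lower i j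

    placeRow₀ : permOn ⊤ Yᵈˣ ≈ minor₀ X
    placeRow₀ = trans (permOn-unitRow ⊤ Yᵈˣ 0F 0F diag-row₀) (1* permOn-cong (⊤ [ 0F ]≔ outside) rows)
      where
      rows : ∀ i j → removeAt Yᵈˣ 0F i j ≈ removeAt X 0F i j
      rows 0F      j = refl
      rows (suc i) j = lower i j

    placeBoth : permOn ⊤ Yᵈᵈ ≈ minor₀₁ X
    placeBoth = trans (permOn-unitRow ⊤ Yᵈᵈ 0F 0F diag-row₀)
                      (1* trans (permOn-unitRow (⊤ [ 0F ]≔ outside) (removeAt Yᵈᵈ 0F) 0F 1F diag-row₁)
                                (1* permOn-cong (⊤ [ 0F ]≔ outside [ 1F ]≔ outside) lower))

  r₀ r₁ r₂ : Fin N → Carrier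
  r₀ 0F = 1#
  r₀ 1F = - h
  r₀ 2F = 1#
  r₀ _  = 0#
  r₁ 0F = 0#
  r₁ 1F = h
  r₁ 2F = 1#
  r₁ 3F = 1#
  r₁ _  = 0#
  r₂ 0F = - 1#
  r₂ 1F = 1# + h
  r₂ 2F = 1#
  r₂ 4F = 1#
  r₂ _  = 0#

  xRows : Matrix → Fin n → Fin N → Carrier
  xRows X i 0F                  = diag i 0F
  xRows X i 1F                  = diag i 1F
  xRows X i 2F                  = 0#
  xRows X i (suc (suc (suc j))) = X i j

  bordered : Matrix → Fin N → Fin N → Carrier
  bordered X = r₀ ∷ r₁ ∷ r₂ ∷ xRows X

  module _ {m} (A : Subset N) (M : Fin m → Fin N → Carrier) where

    private
      offBorder : ∀ {K} (col : Fin K → Fin N) →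
                  ∑[ j < K ] when (lookup A (col j)) (0# * cofactor A M (col j)) ≈ 0#
      offBorder {K} col = ∑-0 {K} _ λ j → when-0 (lookup A (col j)) (zeroˡ _)

    expand-r₀ : permOn A (r₀ ∷ M) ≈ when (lookup A 0F) (1# * cofactor A M 0F)
                                  + (when (lookup A 1F) (- h * cofactor A M 1F)
                                  +  when (lookup A 2F) (1# * cofactor A M 2F))
    expand-r₀ = +-congˡ (+-congˡ (refl +⁰ offBorder (λ j → suc (suc (suc j)))))

    expand-r₁ : permOn A (r₁ ∷ M) ≈ when (lookup A 1F) (h * cofactor A M 1F)
                                  + (when (lookup A 2F) (1# * cofactor A M 2F)
                                  +  when (lookup A 3F) (1# * cofactor A M 3F))
    expand-r₁ = when-0 (lookup A 0F) (zeroˡ _)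
                  ⁰+ +-congˡ (+-congˡ (refl +⁰ offBorder (λ j → suc (suc (suc (suc j))))))

    expand-r₂ : permOn A (r₂ ∷ M) ≈ when (lookup A 0F) (- 1# * cofactor A M 0F)
                                  + (when (lookup A 1F) ((1# + h) * cofactor A M 1F)
                                  + (when (lookup A 2F) (1# * cofactor A M 2F)
                                  +  when (lookup A 4F) (1# * cofactor A M 4F)))
    expand-r₂ = +-congˡ (+-congˡ (+-congˡ (when-0 (lookup A 3F) (zeroˡ _)
                  ⁰+ refl +⁰ offBorder (λ j → suc (suc (suc (suc (suc j))))))))

  -- u and v stand for - 1# and - t. With the cancelling terms moved to the right as
  -- multiples of v + t and u + 1#, this is an identity of commutative semirings.
  collect : ∀ t u v c b₀ b₁ b₀₁ p q →
    (t * c + (((1# + t) * c + b₁) + p))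
      + (v * ((u * c + q) + b₀) + (t * (u * c + q) + (u * p + ((1# + t) * b₀ + b₀₁))))
    ≈ (c + (((t + t) * c + b₁) + (b₀ + b₀₁))) + ((v + t) * ((u * c + q) + b₀) + (u + 1#) * p)
  collect = solve 9 (λ t u v c b₀ b₁ b₀₁ p q →
    (t :* c :+ (((con 1 :+ t) :* c :+ b₁) :+ p))
      :+ (v :* ((u :* c :+ q) :+ b₀) :+ (t :* (u :* c :+ q) :+ (u :* p :+ ((con 1 :+ t) :* b₀ :+ b₀₁))))
    := (c :+ (((t :+ t) :* c :+ b₁) :+ (b₀ :+ b₀₁)))
         :+ ((v :+ t) :* ((u :* c :+ q) :+ b₀) :+ (u :+ con 1) :* p)) refl
    where open import Algebra.Solver.Ring.NaturalCoefficients.Default commutativeSemiring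

  module Expansion (X : Matrix) where

    permX : Subset N → Carrier
    permX S = permOn S (xRows X)

    dropBorderColumns : ∀ {m} (A : Subset n) (M : Fin m → Fin N → Carrier) →
                        permOn (outside Vec.∷ outside Vec.∷ outside Vec.∷ A) M
                        ≈ permOn A (λ i j → M i (suc (suc (suc j))))
    dropBorderColumns A M =
      trans (permOn-dropColumn (outside Vec.∷ outside Vec.∷ A) M)
            (trans (permOn-dropColumn (outside Vec.∷ A) (λ i j → M i (suc j)))
                   (permOn-dropColumn A (λ i j → M i (suc (suc j)))))

    -- The column sets below agree with ⊤ beyond column 4F, so their sizes reduce to the
    -- number of available columns among 0F–4F plus ∣ ⊤ {k} ∣.
    ∣⊤∣≤k : ∣ ⊤ {k} ∣ ≤ k
    ∣⊤∣≤k = ∣p∣≤n ⊤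

    permX-vanishes : ∀ {S} → lookup S 2F ≡ inside → ∣ S ∣ ≤ n → permX S ≈ 0#
    permX-vanishes {S} 2F∈S ∣S∣≤n = permOn-vanishes-zeroColumn S (xRows X) 2F 2F∈S ∣S∣≤n (λ _ → refl)

    permX-perm : permX (⊤ [ 0F ]≔ outside [ 1F ]≔ outside [ 2F ]≔ outside) ≈ permOn ⊤ X
    permX-perm = dropBorderColumns ⊤ (xRows X)

    permX-minor₀ : permX (⊤ [ 1F ]≔ outside [ 2F ]≔ outside [ 3F ]≔ outside) ≈ minor₀ X
    permX-minor₀ =
      trans (permOn-unitColumn _ (xRows X) 0F 0F ≡.refl (s≤s (s≤s ∣⊤∣≤k)) diag-column₀)
            (1* dropBorderColumns (⊤ [ 0F ]≔ outside) (removeAt (xRows X) 0F))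

    permX-minor₁ : permX (⊤ [ 0F ]≔ outside [ 2F ]≔ outside [ 4F ]≔ outside) ≈ minor₁ X
    permX-minor₁ =
      trans (permOn-unitColumn _ (xRows X) 1F 1F ≡.refl (s≤s (s≤s ∣⊤∣≤k)) diag-column₁)
            (1* dropBorderColumns (⊤ [ 1F ]≔ outside) (removeAt (xRows X) 1F))

    permX-minor₀₁ : permX (⊤ [ 2F ]≔ outside [ 3F ]≔ outside [ 4F ]≔ outside) ≈ minor₀₁ X
    permX-minor₀₁ =
      trans (permOn-unitColumn _ (xRows X) 0F 0F ≡.refl (s≤s (s≤s ∣⊤∣≤k)) diag-column₀)
            (1* trans (permOn-unitColumn (⊤ [ 2F ]≔ outside [ 3F ]≔ outside [ 4F ]≔ outside [ 0F ]≔ outside)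
                                         (removeAt (xRows X) 0F) 0F 1F ≡.refl (s≤s ∣⊤∣≤k)
                                         (λ r r≢0 → diag-column₁ (suc r) (r≢0 ∘ suc-injective)))
                      (1* dropBorderColumns (⊤ [ 0F ]≔ outside [ 1F ]≔ outside)
                                            (removeAt (removeAt (xRows X) 0F) 0F)))

    C B₀ B₁ B₀₁ V W : Carrier
    C   = permOn ⊤ X
    B₀  = minor₀ X
    B₁  = minor₁ X
    B₀₁ = minor₀₁ X
    V   = permX (⊤ [ 0F ]≔ outside [ 2F ]≔ outside [ 3F ]≔ outside)
    W   = permX (⊤ [ 1F ]≔ outside [ 2F ]≔ outside [ 4F ]≔ outside)

    afterRow₀ : Fin N → Carrier
    afterRow₀ a = permOn (⊤ [ a ]≔ outside) (r₁ ∷ r₂ ∷ xRows X)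

    afterRows₀₁ : Fin N → Fin N → Carrier
    afterRows₀₁ a b = permOn (⊤ [ a ]≔ outside [ b ]≔ outside) (r₂ ∷ xRows X)

    afterRows₀₁-01 : afterRows₀₁ 0F 1F ≈ C
    afterRows₀₁-01 = trans (expand-r₂ (⊤ [ 0F ]≔ outside [ 1F ]≔ outside) (xRows X))
      (refl ⁰+ refl ⁰+ (1* permX-perm) +⁰ (1* permX-vanishes ≡.refl (s≤s (s≤s ∣⊤∣≤k))))

    afterRows₀₁-02 : afterRows₀₁ 0F 2F ≈ (1# + h) * C + B₁
    afterRows₀₁-02 = trans (expand-r₂ (⊤ [ 0F ]≔ outside [ 2F ]≔ outside) (xRows X))
      (refl ⁰+ +-cong (*-congˡ permX-perm) (refl ⁰+ 1* permX-minor₁))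

    afterRows₀₁-03 : afterRows₀₁ 0F 3F ≈ V
    afterRows₀₁-03 = trans (expand-r₂ (⊤ [ 0F ]≔ outside [ 3F ]≔ outside) (xRows X))
      (refl ⁰+ vanishesʳ (permX-vanishes ≡.refl (s≤s (s≤s ∣⊤∣≤k)))
            ⁰+ (1* refl) +⁰ (1* permX-vanishes ≡.refl (s≤s (s≤s ∣⊤∣≤k))))

    afterRows₀₁-12 : afterRows₀₁ 1F 2F ≈ - 1# * C + W
    afterRows₀₁-12 = trans (expand-r₂ (⊤ [ 1F ]≔ outside [ 2F ]≔ outside) (xRows X))
      (+-cong (*-congˡ permX-perm) (refl ⁰+ refl ⁰+ 1* refl))

    afterRows₀₁-13 : afterRows₀₁ 1F 3F ≈ B₀
    afterRows₀₁-13 = trans (expand-r₂ (⊤ [ 1F ]≔ outside [ 3F ]≔ outside) (xRows X))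
      (vanishesʳ (permX-vanishes ≡.refl (s≤s (s≤s ∣⊤∣≤k)))
        ⁰+ refl ⁰+ (1* permX-minor₀) +⁰ (1* permX-vanishes ≡.refl (s≤s (s≤s ∣⊤∣≤k))))

    afterRows₀₁-23 : afterRows₀₁ 2F 3F ≈ - 1# * V + ((1# + h) * B₀ + B₀₁)
    afterRows₀₁-23 = trans (expand-r₂ (⊤ [ 2F ]≔ outside [ 3F ]≔ outside) (xRows X))
      (+-congˡ (+-cong (*-congˡ permX-minor₀) (refl ⁰+ 1* permX-minor₀₁)))

    afterRow₀-0 : afterRow₀ 0F ≈ h * C + (((1# + h) * C + B₁) + V)
    afterRow₀-0 = trans (expand-r₁ (⊤ [ 0F ]≔ outside) (r₂ ∷ xRows X))
      (+-cong (*-congˡ afterRows₀₁-01) (+-cong (1* afterRows₀₁-02) (1* afterRows₀₁-03)))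

    afterRow₀-1 : afterRow₀ 1F ≈ (- 1# * C + W) + B₀
    afterRow₀-1 = trans (expand-r₁ (⊤ [ 1F ]≔ outside) (r₂ ∷ xRows X))
      (refl ⁰+ +-cong (1* afterRows₀₁-12) (1* afterRows₀₁-13))

    afterRow₀-2 : afterRow₀ 2F ≈ h * (- 1# * C + W) + (- 1# * V + ((1# + h) * B₀ + B₀₁))
    afterRow₀-2 = trans (expand-r₁ (⊤ [ 2F ]≔ outside) (r₂ ∷ xRows X))
      (+-cong (*-congˡ afterRows₀₁-12) (refl ⁰+ 1* afterRows₀₁-23))

    bordered-expansion :
      permOn ⊤ (bordered X) ≈ (h * C + (((1# + h) * C + B₁) + V))
                            + (- h * ((- 1# * C + W) + B₀)
                            + (h * (- 1# * C + W) + (- 1# * V + ((1# + h) * B₀ + B₀₁))))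
    bordered-expansion = trans (expand-r₀ ⊤ (r₁ ∷ r₂ ∷ xRows X))
      (+-cong (1* afterRow₀-0) (+-cong (*-congˡ afterRow₀-1) (1* afterRow₀-2)))

    permOn-+diag≈bordered : h + h ≈ 1# →
                            permOn ⊤ X + permOn ⊤ (λ i j → X i j + diag i j) ≈ permOn ⊤ (bordered X)
    permOn-+diag≈bordered h+h≈1 = sym (begin
      permOn ⊤ (bordered X)
        ≈⟨ bordered-expansion ⟩
      (h * C + (((1# + h) * C + B₁) + V))
        + (- h * ((- 1# * C + W) + B₀) + (h * (- 1# * C + W) + (- 1# * V + ((1# + h) * B₀ + B₀₁))))
        ≈⟨ collect h (- 1#) (- h) C B₀ B₁ B₀₁ V W ⟩
      (C + (((h + h) * C + B₁) + (B₀ + B₀₁))) + ((- h + h) * ((- 1# * C + W) + B₀) + (- 1# + 1#) * V)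
        ≈⟨ +-congˡ (+-congʳ (+-congʳ (trans (*-congʳ h+h≈1) (*-identityˡ C))))
             +⁰ (vanishesˡ (-‿inverseˡ h) ⁰+ vanishesˡ (-‿inverseˡ 1#)) ⟩
      C + ((C + B₁) + (B₀ + B₀₁))
        ≈⟨ +-congˡ (permOn-+diag X) ⟨
      C + permOn ⊤ (λ i j → X i j + diag i j) ∎)
      where open import Relation.Binary.Reasoning.Setoid setoid

-- The witness

module Witness {c ℓ} (F : Field c ℓ) (½ : Field.Carrier F) (k : ℕ) where
  open Field F
  open CommutativeRing commutativeRing using (-_)

  n N : ℕ
  n = suc (suc k)
  N = suc (suc (suc n))

  E₀ : Fin N → Fin N → Entry F n
  E₀ 0F 0F = inj₂ 1#
  E₀ 0F 1F = inj₂ (- ½)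
  E₀ 0F 2F = inj₂ 1#
  E₀ 1F 1F = inj₂ ½
  E₀ 1F 2F = inj₂ 1#
  E₀ 1F 3F = inj₂ 1#
  E₀ 2F 0F = inj₂ (- 1#)
  E₀ 2F 1F = inj₂ (1# + ½)
  E₀ 2F 2F = inj₂ 1#
  E₀ 2F 4F = inj₂ 1#
  E₀ 3F 0F = inj₂ 1#
  E₀ 4F 1F = inj₂ 1#
  E₀ 3F 3F = inj₂ 0#
  E₀ 4F 4F = inj₂ 0#
  E₀ (suc (suc (suc i))) (suc (suc (suc j))) = inj₁ (i , j)
  E₀ _ _ = inj₂ 0#

  n+3≡N : n ℕ.+ 3 ≡ N
  n+3≡N = +-comm n 3

  E : Fin (n ℕ.+ 3) → Fin (n ℕ.+ 3) → Entry F n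
  E i j = E₀ (cast n+3≡N i) (cast n+3≡N j)

module Evaluation {c ℓ a ℓa} {F : Field c ℓ} (A : Algebra F a ℓa) (½ : Field.Carrier F) (k : ℕ)
                  (x : Fin (suc (suc k)) × Fin (suc (suc k)) → CommutativeRing.Carrier (Algebra.ring A)) where
  open Algebra A using (ring; ι; ι-hom)
  open CommutativeRing ring hiding (zero; ring)
  open Field F using () renaming (_≈_ to _≈ᶠ_; _+_ to _+ᶠ_; _*_ to _*ᶠ_; 1# to 1ᶠ)
  open RectangularPermanent ring
  open Bordering ring (ι ½) k
  open Witness F ½ k using (E₀; E; n+3≡N)
  module ι = RingMorphisms.IsRingHomomorphism ι-hom

  X₀ : Matrix
  X₀ = X-sub A k x 0#

  open Expansion X₀ public using (permOn-+diag≈bordered)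

  X-sub-1≈X₀+diag : ∀ i j → X-sub A k x 1# i j ≈ X₀ i j + diag i j
  X-sub-1≈X₀+diag 0F            0F            = sym (+-identityˡ 1#)
  X-sub-1≈X₀+diag 0F            (suc j)       = sym (+-identityʳ _)
  X-sub-1≈X₀+diag 1F            0F            = sym (+-identityʳ _)
  X-sub-1≈X₀+diag 1F            1F            = sym (+-identityˡ 1#)
  X-sub-1≈X₀+diag 1F            (suc (suc j)) = sym (+-identityʳ _)
  X-sub-1≈X₀+diag (suc (suc i)) j             = sym (+-identityʳ _)

  evalEntry-E₀ : ∀ i j → evalEntry A x (E₀ i j) ≈ bordered X₀ i j
  evalEntry-E₀ 0F 0F                                        = ι.1#-homo
  evalEntry-E₀ 0F 1F                                        = ι.-‿homo ½
  evalEntry-E₀ 0F 2F                                        = ι.1#-homo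
  evalEntry-E₀ 0F (suc (suc (suc j)))                       = ι.0#-homo
  evalEntry-E₀ 1F 0F                                        = ι.0#-homo
  evalEntry-E₀ 1F 1F                                        = refl
  evalEntry-E₀ 1F 2F                                        = ι.1#-homo
  evalEntry-E₀ 1F 3F                                        = ι.1#-homo
  evalEntry-E₀ 1F (suc (suc (suc (suc j))))                 = ι.0#-homo
  evalEntry-E₀ 2F 0F                                        = trans (ι.-‿homo _) (-‿cong ι.1#-homo)
  evalEntry-E₀ 2F 1F                                        = trans (ι.+-homo _ ½) (+-congʳ ι.1#-homo)
  evalEntry-E₀ 2F 2F                                        = ι.1#-homo
  evalEntry-E₀ 2F 3F                                        = ι.0#-homo
  evalEntry-E₀ 2F 4F                                        = ι.1#-homo
  evalEntry-E₀ 2F (suc (suc (suc (suc (suc j)))))           = ι.0#-homo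
  evalEntry-E₀ 3F 0F                                        = ι.1#-homo
  evalEntry-E₀ 3F 1F                                        = ι.0#-homo
  evalEntry-E₀ 3F 2F                                        = ι.0#-homo
  evalEntry-E₀ 3F 3F                                        = ι.0#-homo
  evalEntry-E₀ 3F (suc (suc (suc (suc j))))                 = refl
  evalEntry-E₀ 4F 0F                                        = ι.0#-homo
  evalEntry-E₀ 4F 1F                                        = ι.1#-homo
  evalEntry-E₀ 4F 2F                                        = ι.0#-homo
  evalEntry-E₀ 4F 3F                                        = refl
  evalEntry-E₀ 4F 4F                                        = ι.0#-homo
  evalEntry-E₀ 4F (suc (suc (suc (suc (suc j)))))           = refl
  evalEntry-E₀ (suc (suc (suc (suc (suc i))))) 0F           = ι.0#-homo
  evalEntry-E₀ (suc (suc (suc (suc (suc i))))) 1F           = ι.0#-homo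
  evalEntry-E₀ (suc (suc (suc (suc (suc i))))) 2F           = ι.0#-homo
  evalEntry-E₀ (suc (suc (suc (suc (suc i))))) (suc (suc (suc j))) = refl

  ½+½≈1 : (1ᶠ +ᶠ 1ᶠ) *ᶠ ½ ≈ᶠ 1ᶠ → ι ½ + ι ½ ≈ 1#
  ½+½≈1 2·½≈1 = begin
    ι ½ + ι ½                ≈⟨ +-cong (*-identityˡ _) (*-identityˡ _) ⟨
    1# * ι ½ + 1# * ι ½      ≈⟨ distribʳ _ _ _ ⟨
    (1# + 1#) * ι ½          ≈⟨ *-congʳ (trans (ι.+-homo _ _) (+-cong ι.1#-homo ι.1#-homo)) ⟨
    ι (1ᶠ +ᶠ 1ᶠ) * ι ½       ≈⟨ ι.*-homo _ _ ⟨
    ι ((1ᶠ +ᶠ 1ᶠ) *ᶠ ½)      ≈⟨ ι.⟦⟧-cong 2·½≈1 ⟩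
    ι 1ᶠ                     ≈⟨ ι.1#-homo ⟩
    1#                       ∎
    where open import Relation.Binary.Reasoning.Setoid setoid

  ΣPerm≈permOn : ΣPerm A k x ≈ permOn ⊤ X₀ + permOn ⊤ (λ i j → X₀ i j + diag i j)
  ΣPerm≈permOn =
    +-cong (perm≈permOn n X₀) (trans (perm≈permOn n (X-sub A k x 1#)) (permOn-cong ⊤ X-sub-1≈X₀+diag))

  perm-E≈bordered : perm ring (n ℕ.+ 3) (λ i j → evalEntry A x (E i j)) ≈ permOn ⊤ (bordered X₀)
  perm-E≈bordered =
    trans (perm≈permOn (n ℕ.+ 3) (λ i j → evalEntry A x (E i j)))
          (trans (permOn-cast n+3≡N (λ i j → evalEntry A x (E₀ i j))) (permOn-cong ⊤ evalEntry-E₀))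

open import Data.Nat using (_+_)

mainTheorem5 : ∀ {c ℓ} (F : Field c ℓ) → CharNot2 F → (k : ℕ) →
    Σ (Fin (suc (suc k) + 3) → Fin (suc (suc k) + 3) → Entry F (suc (suc k))) λ E →
      (A : Algebra F (c ⊔ ℓ) (c ⊔ ℓ)) →
      (x : Fin (suc (suc k)) × Fin (suc (suc k)) → CommutativeRing.Carrier (Algebra.ring A)) →
      CommutativeRing._≈_ (Algebra.ring A)
        (ΣPerm A k x)
        (perm (Algebra.ring A) (suc (suc k) + 3) (λ i j → evalEntry A x (E i j)))
mainTheorem5 F 1+1≉0 k = Witness.E F ½ k , λ A x →
  let open Evaluation A ½ k x
      open CommutativeRing (Algebra.ring A) using (trans; sym)
  in trans ΣPerm≈permOn (trans (permOn-+diag≈bordered (½+½≈1 2·½≈1)) (sym perm-E≈bordered))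
  where
  open Σ (Field.inverse F _ 1+1≉0) renaming (proj₁ to ½; proj₂ to 2·½≈1)
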